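{- Let $G$ be a series-parallel graph. Then $G$ is $C_5$-critical if and only if there is $i\in\{0,1,2\}$ such that $G$ (as a graph, forgetting terminals) is isomorphic to a parallel sum $G_1\,\|\,G_2$ with $G_1\in\mathcal{F}_{\mathbf{s}(i)}$ and $G_2\in\mathcal{F}_{\bar{\mathbf{s}}(i)}$.
   Context: For graphs $G,H$, an $H$-colouring of $G$ is a map $\phi:V(G)\to V(H)$ sending adjacent vertices to adjacent vertices. We take $V(C_n)=\mathbb{Z}_n$ with $u,v$ adjacent iff $u-v=\pm1$. A graph is $C_{n}$-critical if it has no $C_{n}$-colouring but every proper subgraph has one. A 2-terminal graph $(G,s,t)$ is a graph with two distinct distinguished vertices (terminals) $s,t$. The serial sum $(G_1,s_1,t_1)+(G_2,s_2,t_2)$ is obtained by identifying $t_1$ with $s_2$, with terminals $s_1,t_2$. The parallel sum $(G_1,s_1,t_1)\,\|\,(G_2,s_2,t_2)$ is obtained by identifying $s_1$ with $s_2$ (new terminal $s$) and $t_1$ with $t_2$ (new terminal $t$). A graph $G$ is series-parallel if for some choice of terminals $s,t$, $(G,s,t)$ can be built from single edges ($K_2$ with its two ends as terminals) by serial and parallel sums; a 2-terminal series-parallel graph is such a $(G,s,t)$. For a nonempty $S\subseteq\mathbb{Z}_n$, $(G,s,t)$ is $S$-forcing (with respect to $C_n$) if $S=\{x\in\mathbb{Z}_n:\exists$ a $C_n$-colouring $\phi$ of $G$ with $\phi(s)=0,\phi(t)=x\}$; it is minimally $S$-forcing if it is $S$-forcing but no proper subgraph $(G',s,t)$ (with the same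 terminals) is $S$-forcing. Here $n=5$. For $i\in\mathbb{Z}_5$, $\mathbf{s}(i)=\{i,-i\}$ and $\bar{\mathbf{s}}(i)=\mathbb{Z}_5\setminus\{i,-i\}$. For a symmetric $S\subseteq\mathbb{Z}_5$, $\mathcal{F}_S$ denotes the family of all minimally $S$-forcing 2-terminal series-parallel graphs (with respect to $C_5$). -}

module Defs where

open import Data.Nat using (ℕ; zero; suc)
open import Data.Fin using (Fin; zero; suc; _↑ˡ_; _↑ʳ_; splitAt; punchOut; inject+)
open import Data.Fin.Properties using (_≟_; punchOut-injective; ↑ˡ-injective; splitAt-↑ˡ; splitAt-↑ʳ)
open import Data.Bool using (Bool; true; false)
open import Data.Product using (Σ; ∃; ∃-syntax; _×_; _,_; proj₁; proj₂)
open import Data.Sum using (_⊎_; inj₁; inj₂; [_,_]′)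
open import Data.Empty using (⊥)
open import Relation.Nullary using (¬_; Dec; yes; no; contradiction)
open import Relation.Binary.PropositionalEquality using (_≡_; _≢_; refl; sym; trans; cong)
open import Function using (_∘_)
open import Function.Bundles using (_↔_; _⇔_; Inverse)

-- Finite (multi)graphs: vertices Fin V, edges Fin m, each edge has two
-- ends.  Edges are undirected (the order of the ends is irrelevant
-- for everything below).

record Graph : Set where
  field
    V    : ℕ
    m    : ℕ
    ends : Fin m → Fin V × Fin V
open Graph public

record _≅_ (G H : Graph) : Set where
  field
    vmap : Fin (V G) ↔ Fin (V H)
    emap : Fin (m G) ↔ Fin (m H)
    incid : ∀ e →
      let (a , b) = ends G e
          (c , d) = ends H (Inverse.to emap e)
      in (Inverse.to vmap a ≡ c × Inverse.to vmap b ≡ d)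
         ⊎ (Inverse.to vmap a ≡ d × Inverse.to vmap b ≡ c)

record Subgraph (G : Graph) : Set where
  field
    vkeep : Fin (V G) → Bool
    ekeep : Fin (m G) → Bool
    closed : ∀ e → ekeep e ≡ true →
      vkeep (proj₁ (ends G e)) ≡ true × vkeep (proj₂ (ends G e)) ≡ true
open Subgraph public

Proper : {G : Graph} → Subgraph G → Set
Proper {G} H = (∃[ v ] vkeep H v ≡ false) ⊎ (∃[ e ] ekeep H e ≡ false)

succ5 : Fin 5 → Fin 5
succ5 zero = suc zero
succ5 (suc zero) = suc (suc zero)
succ5 (suc (suc zero)) = suc (suc (suc zero))
succ5 (suc (suc (suc zero))) = suc (suc (suc (suc zero)))
succ5 (suc (suc (suc (suc zero)))) = zero

neg5 : Fin 5 → Fin 5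
neg5 zero = zero
neg5 (suc zero) = suc (suc (suc (suc zero)))
neg5 (suc (suc zero)) = suc (suc (suc zero))
neg5 (suc (suc (suc zero))) = suc (suc zero)
neg5 (suc (suc (suc (suc zero)))) = suc zero

AdjC5 : Fin 5 → Fin 5 → Set
AdjC5 u v = (u ≡ succ5 v) ⊎ (v ≡ succ5 u)

-- A C₅-colouring of a subgraph H of G.  Colours of non-kept vertices are
-- irrelevant (C₅ is nonempty), so we use a total map on V(G).
IsColouringOf : {G : Graph} → Subgraph G → (Fin (V G) → Fin 5) → Set
IsColouringOf {G} H φ =
  ∀ e → ekeep H e ≡ true → AdjC5 (φ (proj₁ (ends G e))) (φ (proj₂ (ends G e)))

full : (G : Graph) → Subgraph G
full G = record { vkeep = λ _ → true ; ekeep = λ _ → true ; closed = λ _ _ → refl , refl }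

IsColouring : (G : Graph) → (Fin (V G) → Fin 5) → Set
IsColouring G = IsColouringOf (full G)

C5Colourable : Graph → Set
C5Colourable G = ∃[ φ ] IsColouring G φ

C5Critical : Graph → Set
C5Critical G = ¬ C5Colourable G ×
  ((H : Subgraph G) → Proper H → ∃[ φ ] IsColouringOf H φ)

record TGraph : Set where
  field
    graph : Graph
    s t   : Fin (V graph)
    s≢t   : s ≢ t
open TGraph public

record _≅ₜ_ (G H : TGraph) : Set where
  field
    iso : graph G ≅ graph H
    pres-s : Inverse.to (_≅_.vmap iso) (s G) ≡ s H
    pres-t : Inverse.to (_≅_.vmap iso) (t G) ≡ t H

K2 : TGraph
K2 = record
  { graph = record { V = 2 ; m = 1 ; ends = λ _ → zero , suc zero }
  ; s = zero ; t = suc zero ; s≢t = λ () }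

mapPair : ∀ {A B : Set} → (A → B) → A × A → B × B
mapPair f (a , b) = f a , f b

↑ˡ≢↑ʳ : ∀ {a b} (i : Fin a) (j : Fin b) → i ↑ˡ b ≢ a ↑ʳ j
↑ˡ≢↑ʳ {a} {b} i j eq with trans (sym (splitAt-↑ˡ a i b)) (trans (cong (splitAt a) eq) (splitAt-↑ʳ a b j))
... | ()

-- Serial sum: identify t₁ with s₂.
serVmap : (V₁ : ℕ) (t₁ : Fin V₁) (k : ℕ) (s₂ : Fin (suc k)) → Fin (suc k) → Fin (V₁ Data.Nat.+ k)
serVmap V₁ t₁ k s₂ v with v ≟ s₂
... | yes _ = t₁ ↑ˡ k
... | no v≢s₂ = V₁ ↑ʳ punchOut {i = s₂} {j = v} (v≢s₂ ∘ sym)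

serT : (V₁ : ℕ) (s₁ t₁ : Fin V₁) (k : ℕ) (s₂ t₂ : Fin (suc k)) → t₂ ≢ s₂ →
       s₁ ↑ˡ k ≢ serVmap V₁ t₁ k s₂ t₂
serT V₁ s₁ t₁ k s₂ t₂ ne with t₂ ≟ s₂
... | yes e = contradiction e ne
... | no ne′ = ↑ˡ≢↑ʳ s₁ _

serialAux : (G₁ : TGraph) (k m₂ : ℕ) (ends₂ : Fin m₂ → Fin (suc k) × Fin (suc k))
            (s₂ t₂ : Fin (suc k)) → s₂ ≢ t₂ → TGraph
serialAux G₁ k m₂ ends₂ s₂ t₂ ne = record
  { graph = record
    { V = V (graph G₁) Data.Nat.+ k
    ; m = m (graph G₁) Data.Nat.+ m₂
    ; ends = λ e → [ (λ e₁ → mapPair (_↑ˡ k) (ends (graph G₁) e₁))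
                   , (λ e₂ → mapPair (serVmap (V (graph G₁)) (t G₁) k s₂) (ends₂ e₂)) ]′
                   (splitAt (m (graph G₁)) e) }
  ; s = s G₁ ↑ˡ k
  ; t = serVmap (V (graph G₁)) (t G₁) k s₂ t₂
  ; s≢t = serT (V (graph G₁)) (s G₁) (t G₁) k s₂ t₂ (ne ∘ sym) }

_⊕_ : TGraph → TGraph → TGraph
G₁ ⊕ record { graph = record { V = zero ; m = m₂ ; ends = ends₂ } ; s = () }
G₁ ⊕ record { graph = record { V = suc k ; m = m₂ ; ends = ends₂ } ; s = s₂ ; t = t₂ ; s≢t = ne } =
  serialAux G₁ k m₂ ends₂ s₂ t₂ ne

-- Parallel sum: identify s₁ with s₂ and t₁ with t₂.
parVmap : (V₁ : ℕ) (s₁ t₁ : Fin V₁) (k : ℕ) (s₂ t₂ : Fin (suc (suc k))) → s₂ ≢ t₂ →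
          Fin (suc (suc k)) → Fin (V₁ Data.Nat.+ k)
parVmap V₁ s₁ t₁ k s₂ t₂ ne v with v ≟ s₂ | v ≟ t₂
... | yes _ | _ = s₁ ↑ˡ k
... | no _ | yes _ = t₁ ↑ˡ k
... | no v≢s₂ | no v≢t₂ =
  V₁ ↑ʳ punchOut {i = punchOut {i = s₂} {j = t₂} ne}
                 {j = punchOut {i = s₂} {j = v} (v≢s₂ ∘ sym)}
                 (λ eq → v≢t₂ (sym (punchOut-injective ne (v≢s₂ ∘ sym) eq)))

parallelAux : (G₁ : TGraph) (k m₂ : ℕ) (ends₂ : Fin m₂ → Fin (suc (suc k)) × Fin (suc (suc k)))
              (s₂ t₂ : Fin (suc (suc k))) → s₂ ≢ t₂ → TGraph
parallelAux G₁ k m₂ ends₂ s₂ t₂ ne = record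
  { graph = record
    { V = V (graph G₁) Data.Nat.+ k
    ; m = m (graph G₁) Data.Nat.+ m₂
    ; ends = λ e → [ (λ e₁ → mapPair (_↑ˡ k) (ends (graph G₁) e₁))
                   , (λ e₂ → mapPair (parVmap (V (graph G₁)) (s G₁) (t G₁) k s₂ t₂ ne) (ends₂ e₂)) ]′
                   (splitAt (m (graph G₁)) e) }
  ; s = s G₁ ↑ˡ k
  ; t = t G₁ ↑ˡ k
  ; s≢t = λ eq → s≢t G₁ (↑ˡ-injective k (s G₁) (t G₁) eq) }

_∥_ : TGraph → TGraph → TGraph
G₁ ∥ record { graph = record { V = zero ; m = m₂ ; ends = ends₂ } ; s = () }
G₁ ∥ record { graph = record { V = suc zero ; m = m₂ ; ends = ends₂ } ; s = zero ; t = zero ; s≢t = ne } =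
  contradiction refl ne
G₁ ∥ record { graph = record { V = suc (suc k) ; m = m₂ ; ends = ends₂ } ; s = s₂ ; t = t₂ ; s≢t = ne } =
  parallelAux G₁ k m₂ ends₂ s₂ t₂ ne

data SPExpr : Set where
  edge : SPExpr
  ser  : SPExpr → SPExpr → SPExpr
  par  : SPExpr → SPExpr → SPExpr

⟦_⟧ : SPExpr → TGraph
⟦ edge ⟧ = K2
⟦ ser a b ⟧ = ⟦ a ⟧ ⊕ ⟦ b ⟧
⟦ par a b ⟧ = ⟦ a ⟧ ∥ ⟦ b ⟧

IsTwoTerminalSP : TGraph → Set
IsTwoTerminalSP G = ∃[ T ] (⟦ T ⟧ ≅ₜ G)

IsSeriesParallel : Graph → Set
IsSeriesParallel G =
  ∃[ s ] ∃[ t ] Σ (s ≢ t) λ ne → IsTwoTerminalSP (record { graph = G ; s = s ; t = t ; s≢t = ne })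

Attainable : (G : TGraph) → Subgraph (graph G) → Fin 5 → Set
Attainable G H x = ∃[ φ ] (IsColouringOf H φ × φ (s G) ≡ zero × φ (t G) ≡ x)

ForcingSub : (Fin 5 → Set) → (G : TGraph) → Subgraph (graph G) → Set
ForcingSub S G H = ∀ x → S x ⇔ Attainable G H x

Forcing : (Fin 5 → Set) → TGraph → Set
Forcing S G = ForcingSub S G (full (graph G))

MinimallyForcing : (Fin 5 → Set) → TGraph → Set
MinimallyForcing S G = Forcing S G ×
  ((H : Subgraph (graph G)) → Proper H →
     vkeep H (s G) ≡ true → vkeep H (t G) ≡ true → ¬ ForcingSub S G H)

InF : (Fin 5 → Set) → TGraph → Set
InF S G = IsTwoTerminalSP G × MinimallyForcing S G

sset : Fin 5 → Fin 5 → Set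
sset i x = (x ≡ i) ⊎ (x ≡ neg5 i)

sbar : Fin 5 → Fin 5 → Set
sbar i x = ¬ sset i x

-- A 2-terminal series-parallel graph G has a profile: the set of colours forced at t when s is coloured 0, and
-- the sets forced by some spanning subgraphs of G with an edge deleted.  Profiles of G ⊕ H and G ∥ H are computed
-- from those of G and H by sumset and intersection in ℤ₅, and starting from K₂ only 19 profiles ever occur.  A
-- C₅-critical graph forces ∅ while each of its edge-deleted subgraphs forces a nonempty set, so an exhaustive check
-- over pairs of these profiles shows that a serial sum is never critical and that a critical parallel sum G₁ ∥ G₂
-- forces s(i) through G₁ and s̄(i) through G₂ (up to order).  Criticality then makes both sides minimally forcing:
-- deleting an edge of G₁ would leave a colour that G₂ also admits.  Conversely, if G₁ and G₂ are minimally
-- s(i)- and s̄(i)-forcing, no colour at t is compatible with both, while deleting an edge of one side frees a colour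
-- that the other side admits; a minimally forcing graph has no isolated vertex, so every proper subgraph of
-- G₁ ∥ G₂ misses an edge.

module Submission where

open import Defs
open import Data.Nat using (ℕ; zero; suc; _+_)
open import Data.Nat.GeneralisedArithmetic using (iterate)
open import Data.Fin using (Fin; zero; suc; toℕ; #_; _↑ˡ_; _↑ʳ_; splitAt; punchIn; punchOut)
open import Data.Fin.Properties
  using (_≟_; any?; all?; ¬∀⟶∃¬; splitAt-↑ˡ; splitAt-↑ʳ; join-splitAt; punchIn-punchOut; punchOut-punchIn;
         punchOut-cong; punchInᵢ≢i; punchIn-injective)
open import Data.Fin.Subset using (Subset; _∈_; ⁅_⁆; _∪_; _∩_; ∁; ⊥; ⊤; Nonempty; Empty)
open import Data.Fin.Subset.Properties
  using (_∈?_; nonempty?; x∈⁅y⁆⇔x≡y; ∪⇔⊎; ∩⇔×; x∈∁p⇒x∉p; x∉p⇒x∈∁p; ∈⊤)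
open import Data.Vec using (tabulate)
open import Data.Vec.Functional as Vector using (updateAt)
open import Data.Vec.Functional.Properties using (updateAt-updates; updateAt-minimal)
open import Data.Vec.Properties using (≡-dec; lookup∘tabulate; []=⇒lookup; lookup⇒[]=)
open import Data.Bool using (Bool; true; false; not)
open import Data.Bool.Properties using (T-≡) renaming (_≟_ to _≟ᵇ_)
open import Data.List using (List; []; _∷_; map; _++_)
open import Data.List.Relation.Unary.All as All using (All; []; _∷_)
open import Data.List.Relation.Unary.All.Properties using (++⁺; map⁺)
open import Data.List.Relation.Unary.Any as Any using (Any; here)
open import Data.List.Membership.Propositional using (find) renaming (_∈_ to _∈ˡ_)
open import Data.Product as Prod using (Σ; ∃; ∃-syntax; _×_; _,_; proj₁; proj₂)
open import Data.Sum as Sum using (_⊎_; inj₁; inj₂; [_,_]′)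
open import Data.Sum.Properties using (inj₁-injective)
open import Data.Empty using (⊥-elim)
open import Function using (_∘_; id; const)
open import Function.Bundles using (_⇔_; mk⇔; Equivalence; Inverse; mk↔ₛ′)
open import Function.Construct.Composition using (_↔-∘_)
open import Relation.Unary using (Decidable)
open import Relation.Nullary using (¬_; Dec; yes; no; does; ¬?; contradiction)
open import Relation.Nullary.Decidable
  using (_×-dec_; _⊎-dec_; _→-dec_; toWitness; dec-true; dec-false; isYes≗does; decidable-stable)
open import Relation.Binary.PropositionalEquality
  using (_≡_; _≢_; refl; sym; trans; cong; subst; subst₂; module ≡-Reasoning)

open Equivalence using (to; from)

infixr 6 _+₅_
_+₅_ : Fin 5 → Fin 5 → Fin 5
a +₅ x = iterate succ5 x (toℕ a)

+₅-identityʳ : ∀ a → a +₅ zero ≡ a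
+₅-identityʳ = toWitness {a? = all? λ a → a +₅ zero ≟ a} _

+₅-inverseˡ : ∀ a → neg5 a +₅ a ≡ zero
+₅-inverseˡ = toWitness {a? = all? λ a → neg5 a +₅ a ≟ zero} _

+₅-cancelˡ : ∀ a x → a +₅ (neg5 a +₅ x) ≡ x
+₅-cancelˡ = toWitness {a? = all? λ a → all? λ x → a +₅ (neg5 a +₅ x) ≟ x} _

module _ {u v : Fin 5} where

  adj-sym : AdjC5 u v → AdjC5 v u
  adj-sym = Sum.swap

  adj-succ5 : AdjC5 u v → AdjC5 (succ5 u) (succ5 v)
  adj-succ5 = Sum.map (cong succ5) (cong succ5)

adj-iterate : ∀ n {u v} → AdjC5 u v → AdjC5 (iterate succ5 u n) (iterate succ5 v n)
adj-iterate zero = id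
adj-iterate (suc n) = adj-iterate n ∘ adj-succ5

adj-+₅ : ∀ a {u v} → AdjC5 u v → AdjC5 (a +₅ u) (a +₅ v)
adj-+₅ a = adj-iterate (toℕ a)

adj? : ∀ u v → Dec (AdjC5 u v)
adj? u v = u ≟ succ5 v ⊎-dec v ≟ succ5 u

module _ {n} {P : Fin n → Set} where

  fromDec : Decidable P → Subset n
  fromDec P? = tabulate (does ∘ P?)

  ∈-fromDec : (P? : Decidable P) {x : Fin n} → x ∈ fromDec P? ⇔ P x
  ∈-fromDec P? {x} = mk⇔
    (λ x∈ → toWitness {a? = P? x} (from T-≡ (trans (isYes≗does (P? x)) (does-true x∈))))
    (λ px → lookup⇒[]= x _ (trans (lookup∘tabulate _ x) (dec-true (P? x) px)))
    where
    does-true : x ∈ fromDec P? → does (P? x) ≡ true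
    does-true x∈ = trans (sym (lookup∘tabulate _ x)) ([]=⇒lookup x∈)

sumset? : ∀ X Y x → Dec (∃[ y ] ∃[ z ] (y ∈ X × z ∈ Y × y +₅ z ≡ x))
sumset? X Y x = any? λ y → any? λ z → y ∈? X ×-dec z ∈? Y ×-dec y +₅ z ≟ x

infixl 6 _⊞_
_⊞_ : Subset 5 → Subset 5 → Subset 5
X ⊞ Y = fromDec (sumset? X Y)

∈-⊞ : ∀ {X Y x} → x ∈ X ⊞ Y ⇔ (∃[ y ] ∃[ z ] (y ∈ X × z ∈ Y × y +₅ z ≡ x))
∈-⊞ {X} {Y} = ∈-fromDec (sumset? X Y)

_≟ˢ_ : (X Y : Subset 5) → Dec (X ≡ Y)
_≟ˢ_ = ≡-dec _≟ᵇ_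

pair : Fin 5 → Subset 5
pair i = ⁅ i ⁆ ∪ ⁅ neg5 i ⁆

sset? : ∀ i x → Dec (sset i x)
sset? i x = x ≟ i ⊎-dec x ≟ neg5 i

∈-pair : ∀ {i x} → x ∈ pair i ⇔ sset i x
∈-pair = mk⇔ (Sum.map (to x∈⁅y⁆⇔x≡y) (to x∈⁅y⁆⇔x≡y) ∘ to ∪⇔⊎)
             (from ∪⇔⊎ ∘ Sum.map (from x∈⁅y⁆⇔x≡y) (from x∈⁅y⁆⇔x≡y))

∈-∁pair : ∀ {i x} → x ∈ ∁ (pair i) ⇔ sbar i x
∈-∁pair = mk⇔ (λ x∈ → x∈∁p⇒x∉p x∈ ∘ from ∈-pair)
              (λ x∉ → x∉p⇒x∈∁p (x∉ ∘ to ∈-pair))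

sbar-nonempty : ∀ i → ∃[ y ] sbar i y
sbar-nonempty = toWitness {a? = all? λ i → any? λ y → ¬? (sset? i y)} _

-- Colourings of subgraphs

edgeSubgraph : (G : Graph) → (Fin (m G) → Bool) → Subgraph G
edgeSubgraph G f = record { vkeep = const true ; ekeep = f ; closed = λ _ _ → refl , refl }

module _ {G : Graph} where

  colouring-mono : (H K : Subgraph G) {φ : Fin (V G) → Fin 5} →
    (∀ e → ekeep K e ≡ true → ekeep H e ≡ true) → IsColouringOf H φ → IsColouringOf K φ
  colouring-mono H K K⊆H col e k = col e (K⊆H e k)

  colouring-cong : (H : Subgraph G) {φ ψ : Fin (V G) → Fin 5} →
    (∀ v → φ v ≡ ψ v) → IsColouringOf H φ → IsColouringOf H ψ
  colouring-cong H φ≗ψ col e k = subst₂ AdjC5 (φ≗ψ _) (φ≗ψ _) (col e k)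

  colouring-+₅ : (H : Subgraph G) {φ : Fin (V G) → Fin 5} (a : Fin 5) →
    IsColouringOf H φ → IsColouringOf H ((a +₅_) ∘ φ)
  colouring-+₅ H a col e k = adj-+₅ a (col e k)

  colouring? : (H : Subgraph G) (φ : Fin (V G) → Fin 5) → Dec (IsColouringOf H φ)
  colouring? H φ = all? λ e → ekeep H e ≟ᵇ true →-dec adj? _ _

∃-function? : ∀ n {k} {P : (Fin n → Fin k) → Set} →
  (∀ {φ ψ} → (∀ i → φ i ≡ ψ i) → P φ → P ψ) → (∀ φ → Dec (P φ)) → Dec (∃ P)
∃-function? zero resp P? with P? (λ ())
... | yes p = yes (_ , p)
... | no ¬p = no λ (φ , p) → ¬p (resp (λ ()) p)
∃-function? (suc n) {k} resp P?
  with any? (λ c → ∃-function? n (resp ∘ ∷-cong c) (P? ∘ (c Vector.∷_)))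
  where
  ∷-cong : ∀ c {φ ψ : Fin n → Fin k} → (∀ i → φ i ≡ ψ i) →
    ∀ i → (c Vector.∷ φ) i ≡ (c Vector.∷ ψ) i
  ∷-cong c φ≗ψ zero = refl
  ∷-cong c φ≗ψ (suc i) = φ≗ψ i
... | yes (c , φ , p) = yes (c Vector.∷ φ , p)
... | no ¬p = no λ (φ , p) → ¬p (Vector.head φ , Vector.tail φ , resp (head∷tail φ) p)
  where
  head∷tail : ∀ (φ : Fin (suc n) → Fin k) i → φ i ≡ (Vector.head φ Vector.∷ Vector.tail φ) i
  head∷tail φ zero = refl
  head∷tail φ (suc i) = refl

module _ (G : TGraph) where

  attainable-mono : (H K : Subgraph (graph G)) → (∀ e → ekeep K e ≡ true → ekeep H e ≡ true) →
    ∀ {x} → Attainable G H x → Attainable G K x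
  attainable-mono H K K⊆H (φ , col , φs , φt) = φ , colouring-mono H K {φ} K⊆H col , φs , φt

  attainable-spanning : ∀ f {x} → Attainable G (full (graph G)) x → Attainable G (edgeSubgraph (graph G) f) x
  attainable-spanning f = attainable-mono (full (graph G)) (edgeSubgraph (graph G) f) (λ _ _ → refl)

  attainable-colouring : (H : Subgraph (graph G)) {φ : Fin (V (graph G)) → Fin 5} → IsColouringOf H φ →
    Attainable G H (neg5 (φ (s G)) +₅ φ (t G))
  attainable-colouring H {φ} col =
    (neg5 (φ (s G)) +₅_) ∘ φ , colouring-+₅ H {φ} (neg5 (φ (s G))) col , +₅-inverseˡ (φ (s G)) , refl

  attainable? : (H : Subgraph (graph G)) (x : Fin 5) → Dec (Attainable G H x)
  attainable? H x = ∃-function? (V (graph G))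
    (λ φ≗ψ (col , φs , φt) →
      colouring-cong H φ≗ψ col , trans (sym (φ≗ψ _)) φs , trans (sym (φ≗ψ _)) φt)
    (λ φ → colouring? H φ ×-dec φ (s G) ≟ zero ×-dec φ (t G) ≟ x)

Avoids : ∀ {A : Set} → A → A × A → Set
Avoids u (a , b) = a ≢ u × b ≢ u

Isolated : (G : Graph) → Fin (V G) → Set
Isolated G u = ∀ e → Avoids u (ends G e)

module _ {G : Graph} {u : Fin (V G)} (isolated : Isolated G u) where

  deleteIsolated-kept : ∀ {v} → v ≢ u → not (does (v ≟ u)) ≡ true
  deleteIsolated-kept v≢u = cong not (dec-false (_ ≟ u) v≢u)

  deleteIsolated : Subgraph G
  deleteIsolated = record
    { vkeep = λ v → not (does (v ≟ u))
    ; ekeep = const true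
    ; closed = λ e _ → deleteIsolated-kept (proj₁ (isolated e)) , deleteIsolated-kept (proj₂ (isolated e)) }

  deleteIsolated-proper : Proper deleteIsolated
  deleteIsolated-proper = inj₁ (u , cong not (dec-true (u ≟ u) refl))

  colouring-update : (H : Subgraph G) {φ : Fin (V G) → Fin 5} (c : Fin 5) →
    IsColouringOf H φ → IsColouringOf H (updateAt φ u (const c))
  colouring-update H {φ} c col e k = subst₂ AdjC5
    (sym (updateAt-minimal _ u φ (proj₁ (isolated e))))
    (sym (updateAt-minimal _ u φ (proj₂ (isolated e))))
    (col e k)

critical⇒¬isolated : ∀ {G u} → C5Critical G → ¬ Isolated G u
critical⇒¬isolated (uncolourable , critical) isolated =
  uncolourable (critical (deleteIsolated isolated) (deleteIsolated-proper isolated))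

kept≢dropped : ∀ {G} (H : Subgraph G) {u v} → vkeep H u ≡ true → vkeep H v ≡ false → u ≢ v
kept≢dropped H u∈H v∉H refl = contradiction (trans (sym u∈H) v∉H) λ ()

spanning-proper⇒isolated : ∀ {G} (H : Subgraph G) → (∀ e → ekeep H e ≡ true) → Proper H →
  ∃[ v ] (vkeep H v ≡ false × Isolated G v)
spanning-proper⇒isolated H spanning (inj₂ (e , e∉H)) = contradiction (trans (sym (spanning e)) e∉H) λ ()
spanning-proper⇒isolated H spanning (inj₁ (v , v∉H)) = v , v∉H , λ e →
  Prod.map (λ a∈H → kept≢dropped H a∈H v∉H) (λ b∈H → kept≢dropped H b∈H v∉H) (closed H e (spanning e))

-- Isomorphisms

-- _≅_.incid I e says Matches H (to e) (to a) (to b), where a and b are the ends of e.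
Matches : (H : Graph) → Fin (m H) → Fin (V H) → Fin (V H) → Set
Matches H e a b =
  (a ≡ proj₁ (ends H e) × b ≡ proj₂ (ends H e)) ⊎ (a ≡ proj₂ (ends H e) × b ≡ proj₁ (ends H e))

module _ (H : Graph) (e : Fin (m H)) (R : Fin (V H) → Fin (V H) → Set) (R-sym : ∀ {a b} → R a b → R b a)
  where

  matches-ends : ∀ {a b} → Matches H e a b → R a b → R (proj₁ (ends H e)) (proj₂ (ends H e))
  matches-ends (inj₁ (p , q)) r = subst₂ R p q r
  matches-ends (inj₂ (p , q)) r = R-sym (subst₂ R p q r)

  ends-matches : ∀ {a b} → Matches H e a b → R (proj₁ (ends H e)) (proj₂ (ends H e)) → R a b
  ends-matches (inj₁ (p , q)) r = subst₂ R (sym p) (sym q) r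
  ends-matches (inj₂ (p , q)) r = R-sym (subst₂ R (sym q) (sym p) r)

matches-sym : ∀ {H e a b} → Matches H e a b → Matches H e b a
matches-sym = Sum.swap ∘ Sum.map Prod.swap Prod.swap

module _ {G H : Graph} (I : G ≅ H) where
  private
    module vmap = Inverse (_≅_.vmap I)
    module emap = Inverse (_≅_.emap I)

  preimage : Subgraph H → Subgraph G
  preimage K = record
    { vkeep = vkeep K ∘ vmap.to
    ; ekeep = ekeep K ∘ emap.to
    ; closed = λ e k → ends-matches H (emap.to e) (λ a b → vkeep K a ≡ true × vkeep K b ≡ true) Prod.swap
                         (_≅_.incid I e) (closed K (emap.to e) k) }

  colouring-preimage : (K : Subgraph H) {ψ : Fin (V H) → Fin 5} →
    IsColouringOf K ψ → IsColouringOf (preimage K) (ψ ∘ vmap.to)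
  colouring-preimage K {ψ} col e k =
    ends-matches H (emap.to e) (λ a b → AdjC5 (ψ a) (ψ b)) adj-sym (_≅_.incid I e) (col (emap.to e) k)

≅-refl : ∀ {G} → G ≅ G
≅-refl = record
  { vmap = mk↔ₛ′ id id (λ _ → refl) (λ _ → refl)
  ; emap = mk↔ₛ′ id id (λ _ → refl) (λ _ → refl)
  ; incid = λ _ → inj₁ (refl , refl) }

≅-sym : ∀ {G H} → G ≅ H → H ≅ G
≅-sym {G} {H} I = record
  { vmap = mk↔ₛ′ vmap.from vmap.to vmap.strictlyInverseʳ vmap.strictlyInverseˡ
  ; emap = mk↔ₛ′ emap.from emap.to emap.strictlyInverseʳ emap.strictlyInverseˡ
  ; incid = incid }
  where
  module vmap = Inverse (_≅_.vmap I)
  module emap = Inverse (_≅_.emap I)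

  incid : ∀ e → Matches G (emap.from e) (vmap.from (proj₁ (ends H e))) (vmap.from (proj₂ (ends H e)))
  incid e = subst (λ e′ → R (proj₁ (ends H e′)) (proj₂ (ends H e′))) (emap.strictlyInverseˡ e)
                  (matches-ends H _ R (matches-sym {G} {emap.from e}) (_≅_.incid I (emap.from e))
                    (inj₁ (vmap.strictlyInverseʳ _ , vmap.strictlyInverseʳ _)))
    where
    R : Fin (V H) → Fin (V H) → Set
    R a b = Matches G (emap.from e) (vmap.from a) (vmap.from b)

≅-trans : ∀ {G H K} → G ≅ H → H ≅ K → G ≅ K
≅-trans {G} {H} {K} I J = record
  { vmap = _≅_.vmap J ↔-∘ _≅_.vmap I
  ; emap = _≅_.emap J ↔-∘ _≅_.emap I
  ; incid = λ e → ends-matches H (eI e) (R e) (matches-sym {K} {eJ (eI e)})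
                    (_≅_.incid I e) (_≅_.incid J (eI e)) }
  where
  eI : Fin (m G) → Fin (m H)
  eI = Inverse.to (_≅_.emap I)
  eJ : Fin (m H) → Fin (m K)
  eJ = Inverse.to (_≅_.emap J)
  vJ : Fin (V H) → Fin (V K)
  vJ = Inverse.to (_≅_.vmap J)
  R : Fin (m G) → Fin (V H) → Fin (V H) → Set
  R e a b = Matches K (eJ (eI e)) (vJ a) (vJ b)

critical-≅ : ∀ {G H} → G ≅ H → C5Critical H → C5Critical G
critical-≅ {G} {H} I (uncolourable , critical) = uncolourable′ , critical′
  where
  module vmap = Inverse (_≅_.vmap I)
  module emap = Inverse (_≅_.emap I)

  uncolourable′ : ¬ C5Colourable G
  uncolourable′ (φ , col) = uncolourable (φ ∘ vmap.from , colouring-preimage (≅-sym I) (full G) {φ} col)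

  preimage-proper : (K : Subgraph G) → Proper K → Proper (preimage (≅-sym I) K)
  preimage-proper K (inj₁ (v , v∉K)) = inj₁ (vmap.to v , trans (cong (vkeep K) (vmap.strictlyInverseʳ v)) v∉K)
  preimage-proper K (inj₂ (e , e∉K)) = inj₂ (emap.to e , trans (cong (ekeep K) (emap.strictlyInverseʳ e)) e∉K)

  critical′ : (K : Subgraph G) → Proper K → ∃[ φ ] IsColouringOf K φ
  critical′ K proper with critical (preimage (≅-sym I) K) (preimage-proper K proper)
  ... | ψ , col = ψ ∘ vmap.to ,
    colouring-mono (preimage I (preimage (≅-sym I) K)) K {ψ ∘ vmap.to}
      (λ e e∈K → trans (cong (ekeep K) (emap.strictlyInverseʳ e)) e∈K)
      (colouring-preimage I (preimage (≅-sym I) K) {ψ} col)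

-- Gluings of two graphs

record Gluing (A B P : Graph) : Set where
  field
    ι₁ : Fin (V A) → Fin (V P)
    ι₂ : Fin (V B) → Fin (V P)
    vsplit : Fin (V P) → Fin (V A) ⊎ Fin (V B)
    vsplit-ι₁ : ∀ u → vsplit (ι₁ u) ≡ inj₁ u
    ι-vsplit : ∀ w → [ ι₁ , ι₂ ]′ (vsplit w) ≡ w
    ε₁ : Fin (m A) → Fin (m P)
    ε₂ : Fin (m B) → Fin (m P)
    esplit : Fin (m P) → Fin (m A) ⊎ Fin (m B)
    esplit-ε₁ : ∀ e → esplit (ε₁ e) ≡ inj₁ e
    esplit-ε₂ : ∀ e → esplit (ε₂ e) ≡ inj₂ e
    ε-esplit : ∀ e → [ ε₁ , ε₂ ]′ (esplit e) ≡ e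
    ends-ε₁ : ∀ e → ends P (ε₁ e) ≡ mapPair ι₁ (ends A e)
    ends-ε₂ : ∀ e → ends P (ε₂ e) ≡ mapPair ι₂ (ends B e)

module GluingProperties {A B P : Graph} (𝒢 : Gluing A B P) where
  open Gluing 𝒢 public

  ι₁-injective : ∀ {u v} → ι₁ u ≡ ι₁ v → u ≡ v
  ι₁-injective {u} {v} eq = inj₁-injective (trans (sym (vsplit-ι₁ u)) (trans (cong vsplit eq) (vsplit-ι₁ v)))

  joinMask : (Fin (m A) → Bool) → (Fin (m B) → Bool) → Fin (m P) → Bool
  joinMask fA fB = [ fA , fB ]′ ∘ esplit

  joinMask-ε₁ : ∀ fA fB e → joinMask fA fB (ε₁ e) ≡ fA e
  joinMask-ε₁ fA fB e = cong [ fA , fB ]′ (esplit-ε₁ e)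

  joinMask-ε₂ : ∀ fA fB e → joinMask fA fB (ε₂ e) ≡ fB e
  joinMask-ε₂ fA fB e = cong [ fA , fB ]′ (esplit-ε₂ e)

  mask-split : (f : Fin (m P) → Bool) → (∀ e → f (ε₁ e) ≡ true) → (∀ e → f (ε₂ e) ≡ true) →
    ∀ e → f e ≡ true
  mask-split f f₁ f₂ e with esplit e | ε-esplit e
  ... | inj₁ e₁ | refl = f₁ e₁
  ... | inj₂ e₂ | refl = f₂ e₂

  restrict₁ : ∀ f {φ} → IsColouringOf (edgeSubgraph P f) φ →
    IsColouringOf (edgeSubgraph A (f ∘ ε₁)) (φ ∘ ι₁)
  restrict₁ f {φ} col e k = subst (λ (a , b) → AdjC5 (φ a) (φ b)) (ends-ε₁ e) (col (ε₁ e) k)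

  restrict₂ : ∀ f {φ} → IsColouringOf (edgeSubgraph P f) φ →
    IsColouringOf (edgeSubgraph B (f ∘ ε₂)) (φ ∘ ι₂)
  restrict₂ f {φ} col e k = subst (λ (a , b) → AdjC5 (φ a) (φ b)) (ends-ε₂ e) (col (ε₂ e) k)

  glue : (Fin (V A) → Fin 5) → (Fin (V B) → Fin 5) → Fin (V P) → Fin 5
  glue φA φB = [ φA , φB ]′ ∘ vsplit

  glue-ι₁ : ∀ φA φB u → glue φA φB (ι₁ u) ≡ φA u
  glue-ι₁ φA φB u = cong [ φA , φB ]′ (vsplit-ι₁ u)

  glue-colouring : ∀ f φA φB → (∀ u → glue φA φB (ι₂ u) ≡ φB u) →
    IsColouringOf (edgeSubgraph A (f ∘ ε₁)) φA → IsColouringOf (edgeSubgraph B (f ∘ ε₂)) φB →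
    IsColouringOf (edgeSubgraph P f) (glue φA φB)
  glue-colouring f φA φB glue-ι₂ colA colB e k with esplit e | ε-esplit e
  ... | inj₁ e₁ | refl = subst (λ (a , b) → AdjC5 (glue φA φB a) (glue φA φB b)) (sym (ends-ε₁ e₁))
                           (subst₂ AdjC5 (sym (glue-ι₁ φA φB _)) (sym (glue-ι₁ φA φB _)) (colA e₁ k))
  ... | inj₂ e₂ | refl = subst (λ (a , b) → AdjC5 (glue φA φB a) (glue φA φB b)) (sym (ends-ε₂ e₂))
                           (subst₂ AdjC5 (sym (glue-ι₂ _)) (sym (glue-ι₂ _)) (colB e₂ k))

  isolated-split : ∀ {w} → Isolated P w → (∃[ u ] Isolated A u) ⊎ (∃[ u ] Isolated B u)
  isolated-split {w} isolated with vsplit w | ι-vsplit w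
  ... | inj₁ u | refl = inj₁ (u , λ e →
    Prod.map (_∘ cong ι₁) (_∘ cong ι₁) (subst (Avoids (ι₁ u)) (ends-ε₁ e) (isolated (ε₁ e))))
  ... | inj₂ u | refl = inj₂ (u , λ e →
    Prod.map (_∘ cong ι₂) (_∘ cong ι₂) (subst (Avoids (ι₂ u)) (ends-ε₂ e) (isolated (ε₂ e))))

  isolated-ι₁ : ∀ {u} → (∀ v → ι₂ v ≢ ι₁ u) → Isolated A u → Isolated P (ι₁ u)
  isolated-ι₁ {u} ι₂≢ι₁u isolated e with esplit e | ε-esplit e
  ... | inj₁ e₁ | refl =
    subst (Avoids (ι₁ u)) (sym (ends-ε₁ e₁)) (Prod.map (_∘ ι₁-injective) (_∘ ι₁-injective) (isolated e₁))
  ... | inj₂ e₂ | refl = subst (Avoids (ι₁ u)) (sym (ends-ε₂ e₂)) (ι₂≢ι₁u _ , ι₂≢ι₁u _)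

record ParallelGluing (A B P : TGraph) : Set where
  field
    gluing : Gluing (graph A) (graph B) (graph P)
  open Gluing gluing
  field
    ι₁-s : ι₁ (s A) ≡ s P
    ι₁-t : ι₁ (t A) ≡ t P
    ι₂-s : ι₂ (s B) ≡ s P
    ι₂-t : ι₂ (t B) ≡ t P
    vsplit-ι₂ : ∀ u → u ≢ s B → u ≢ t B → vsplit (ι₂ u) ≡ inj₂ u

module ParallelGluingProperties {A B P : TGraph} (𝒫 : ParallelGluing A B P) where
  open ParallelGluing 𝒫 public
  open GluingProperties gluing public
  open ≡-Reasoning

  glue-ι₂ : ∀ φA φB → φA (s A) ≡ φB (s B) → φA (t A) ≡ φB (t B) →
    ∀ u → glue φA φB (ι₂ u) ≡ φB u
  glue-ι₂ φA φB same-s same-t u with u ≟ s B | u ≟ t B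
  ... | yes refl | _ = begin
    glue φA φB (ι₂ (s B)) ≡⟨ cong (glue φA φB) (trans ι₂-s (sym ι₁-s)) ⟩
    glue φA φB (ι₁ (s A)) ≡⟨ glue-ι₁ φA φB (s A) ⟩
    φA (s A)              ≡⟨ same-s ⟩
    φB (s B)              ∎
  ... | no _ | yes refl = begin
    glue φA φB (ι₂ (t B)) ≡⟨ cong (glue φA φB) (trans ι₂-t (sym ι₁-t)) ⟩
    glue φA φB (ι₁ (t A)) ≡⟨ glue-ι₁ φA φB (t A) ⟩
    φA (t A)              ≡⟨ same-t ⟩
    φB (t B)              ∎
  ... | no u≢s | no u≢t = cong [ φA , φB ]′ (vsplit-ι₂ u u≢s u≢t)

  attainable-parallel : ∀ f {x} → Attainable P (edgeSubgraph (graph P) f) x ⇔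
    (Attainable A (edgeSubgraph (graph A) (f ∘ ε₁)) x × Attainable B (edgeSubgraph (graph B) (f ∘ ε₂)) x)
  attainable-parallel f = mk⇔
    (λ (φ , col , φs , φt) →
      (φ ∘ ι₁ , restrict₁ f {φ} col , trans (cong φ ι₁-s) φs , trans (cong φ ι₁-t) φt) ,
      (φ ∘ ι₂ , restrict₂ f {φ} col , trans (cong φ ι₂-s) φs , trans (cong φ ι₂-t) φt))
    (λ ((φA , colA , φAs , φAt) , (φB , colB , φBs , φBt)) →
      glue φA φB ,
      glue-colouring f φA φB (glue-ι₂ φA φB (trans φAs (sym φBs)) (trans φAt (sym φBt))) colA colB ,
      trans (cong (glue φA φB) (sym ι₁-s)) (trans (glue-ι₁ φA φB (s A)) φAs) ,
      trans (cong (glue φA φB) (sym ι₁-t)) (trans (glue-ι₁ φA φB (t A)) φAt))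

  ι₂≢ι₁ : ∀ {u v} → v ≢ s A → v ≢ t A → ι₂ u ≢ ι₁ v
  ι₂≢ι₁ {u} {v} v≢s v≢t eq with u ≟ s B | u ≟ t B
  ... | yes refl | _ = v≢s (sym (ι₁-injective (trans ι₁-s (trans (sym ι₂-s) eq))))
  ... | no _ | yes refl = v≢t (sym (ι₁-injective (trans ι₁-t (trans (sym ι₂-t) eq))))
  ... | no u≢s | no u≢t with () ← trans (sym (vsplit-ι₂ u u≢s u≢t)) (trans (cong vsplit eq) (vsplit-ι₁ v))

  glued-colouring : ∀ (H : Subgraph (graph P)) {x} →
    Attainable A (edgeSubgraph _ (ekeep H ∘ ε₁)) x → Attainable B (edgeSubgraph _ (ekeep H ∘ ε₂)) x →
    ∃[ φ ] IsColouringOf H φ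
  glued-colouring H attA attB = let (φ , col , _) = from (attainable-parallel (ekeep H)) (attA , attB) in φ , col

record SerialGluing (A B P : TGraph) : Set where
  field
    gluing : Gluing (graph A) (graph B) (graph P)
  open Gluing gluing
  field
    ι₁-s : ι₁ (s A) ≡ s P
    ι₂-t : ι₂ (t B) ≡ t P
    ι₂-s : ι₂ (s B) ≡ ι₁ (t A)
    vsplit-ι₂ : ∀ u → u ≢ s B → vsplit (ι₂ u) ≡ inj₂ u

module SerialGluingProperties {A B P : TGraph} (𝒮 : SerialGluing A B P) where
  open SerialGluing 𝒮 public
  open GluingProperties gluing public
  open ≡-Reasoning

  glue-ι₂ : ∀ φA φB → φA (t A) ≡ φB (s B) → ∀ u → glue φA φB (ι₂ u) ≡ φB u
  glue-ι₂ φA φB same-mid u with u ≟ s B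
  ... | yes refl = begin
    glue φA φB (ι₂ (s B)) ≡⟨ cong (glue φA φB) ι₂-s ⟩
    glue φA φB (ι₁ (t A)) ≡⟨ glue-ι₁ φA φB (t A) ⟩
    φA (t A)              ≡⟨ same-mid ⟩
    φB (s B)              ∎
  ... | no u≢s = cong [ φA , φB ]′ (vsplit-ι₂ u u≢s)

  SumOfAttainable : (Fin (m (graph P)) → Bool) → Fin 5 → Set
  SumOfAttainable f x = ∃[ y ] ∃[ z ] (Attainable A (edgeSubgraph (graph A) (f ∘ ε₁)) y ×
                                       Attainable B (edgeSubgraph (graph B) (f ∘ ε₂)) z × y +₅ z ≡ x)

  attainable-serial : ∀ f {x} → Attainable P (edgeSubgraph (graph P) f) x ⇔ SumOfAttainable f x
  attainable-serial f = mk⇔ split join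
    where
    split : ∀ {x} → Attainable P (edgeSubgraph (graph P) f) x → SumOfAttainable f x
    split {x} (φ , col , φs , φt) =
      y , neg5 y +₅ x ,
      (φ ∘ ι₁ , restrict₁ f {φ} col , trans (cong φ ι₁-s) φs , refl) ,
      ((neg5 y +₅_) ∘ φ ∘ ι₂ ,
        colouring-+₅ (edgeSubgraph _ (f ∘ ε₂)) {φ ∘ ι₂} (neg5 y) (restrict₂ f {φ} col) ,
        trans (cong (λ w → neg5 y +₅ φ w) ι₂-s) (+₅-inverseˡ y) ,
        cong (neg5 y +₅_) (trans (cong φ ι₂-t) φt)) ,
      +₅-cancelˡ y x
      where
      y : Fin 5
      y = φ (ι₁ (t A))
    join : ∀ {x} → SumOfAttainable f x → Attainable P (edgeSubgraph (graph P) f) x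
    join (y , z , (φA , colA , φAs , φAt) , (φB , colB , φBs , φBt) , refl) =
      glue φA φB′ ,
      glue-colouring f φA φB′ (glue-ι₂ φA φB′ mid) colA
        (colouring-+₅ (edgeSubgraph _ (f ∘ ε₂)) {φB} y colB) ,
      trans (cong (glue φA φB′) (sym ι₁-s)) (trans (glue-ι₁ φA φB′ (s A)) φAs) ,
      trans (cong (glue φA φB′) (sym ι₂-t)) (trans (glue-ι₂ φA φB′ mid (t B)) (cong (y +₅_) φBt))
      where
      φB′ : Fin (V (graph B)) → Fin 5
      φB′ = (y +₅_) ∘ φB
      mid : φA (t A) ≡ y +₅ φB (s B)
      mid = trans φAt (sym (trans (cong (y +₅_) φBs) (+₅-identityʳ y)))

module ParallelConstruction (A : TGraph) (k m₂ : ℕ) (ends₂ : Fin m₂ → Fin (suc (suc k)) × Fin (suc (suc k)))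
                            (s₂ t₂ : Fin (suc (suc k))) (s₂≢t₂ : s₂ ≢ t₂)
  where
  B : TGraph
  B = record { graph = record { V = suc (suc k) ; m = m₂ ; ends = ends₂ } ; s = s₂ ; t = t₂ ; s≢t = s₂≢t₂ }

  ι₂ : Fin (suc (suc k)) → Fin (V (graph A) + k)
  ι₂ = parVmap (V (graph A)) (s A) (t A) k s₂ t₂ s₂≢t₂

  t₂′ : Fin (suc k)
  t₂′ = punchOut s₂≢t₂

  inner : Fin k → Fin (suc (suc k))
  inner j = punchIn s₂ (punchIn t₂′ j)

  inner≢s : ∀ j → inner j ≢ s₂
  inner≢s j = punchInᵢ≢i s₂ _

  inner≢t : ∀ j → inner j ≢ t₂
  inner≢t j eq = punchInᵢ≢i t₂′ j (punchIn-injective s₂ _ _ (trans eq (sym (punchIn-punchOut s₂≢t₂))))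

  vsplit : Fin (V (graph A) + k) → Fin (V (graph A)) ⊎ Fin (suc (suc k))
  vsplit w = [ inj₁ , inj₂ ∘ inner ]′ (splitAt (V (graph A)) w)

  ι₂-inner : ∀ j → ι₂ (inner j) ≡ V (graph A) ↑ʳ j
  ι₂-inner j with inner j ≟ s₂ | inner j ≟ t₂
  ... | yes eq | _ = contradiction eq (inner≢s j)
  ... | no _ | yes eq = contradiction eq (inner≢t j)
  ... | no _ | no _ = cong (V (graph A) ↑ʳ_)
    (trans (punchOut-cong t₂′ (trans (punchOut-cong s₂ refl) (punchOut-punchIn s₂))) (punchOut-punchIn t₂′))

  ι₂-s : ι₂ s₂ ≡ s A ↑ˡ k
  ι₂-s with s₂ ≟ s₂
  ... | yes _ = refl
  ... | no s₂≢s₂ = contradiction refl s₂≢s₂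

  ι₂-t : ι₂ t₂ ≡ t A ↑ˡ k
  ι₂-t with t₂ ≟ s₂ | t₂ ≟ t₂
  ... | yes eq | _ = contradiction (sym eq) s₂≢t₂
  ... | no _ | yes _ = refl
  ... | no _ | no t₂≢t₂ = contradiction refl t₂≢t₂

  vsplit-ι₂ : ∀ u → u ≢ s₂ → u ≢ t₂ → vsplit (ι₂ u) ≡ inj₂ u
  vsplit-ι₂ u u≢s u≢t with u ≟ s₂ | u ≟ t₂
  ... | yes eq | _ = contradiction eq u≢s
  ... | no _ | yes eq = contradiction eq u≢t
  ... | no _ | no _ = trans (cong [ inj₁ , inj₂ ∘ inner ]′ (splitAt-↑ʳ (V (graph A)) k _))
                        (cong inj₂ (trans (cong (punchIn s₂) (punchIn-punchOut _)) (punchIn-punchOut _)))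

  gluing : Gluing (graph A) (graph B) (graph (A ∥ B))
  gluing = record
    { ι₁ = _↑ˡ k
    ; ι₂ = ι₂
    ; vsplit = vsplit
    ; vsplit-ι₁ = λ u → cong [ inj₁ , inj₂ ∘ inner ]′ (splitAt-↑ˡ (V (graph A)) u k)
    ; ι-vsplit = ι-vsplit
    ; ε₁ = _↑ˡ m₂
    ; ε₂ = m (graph A) ↑ʳ_
    ; esplit = splitAt (m (graph A))
    ; esplit-ε₁ = λ e → splitAt-↑ˡ (m (graph A)) e m₂
    ; esplit-ε₂ = splitAt-↑ʳ (m (graph A)) m₂
    ; ε-esplit = join-splitAt (m (graph A)) m₂
    ; ends-ε₁ = λ e → cong ends′ (splitAt-↑ˡ (m (graph A)) e m₂)
    ; ends-ε₂ = λ e → cong ends′ (splitAt-↑ʳ (m (graph A)) m₂ e) }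
    where
    ι-vsplit : ∀ w → [ _↑ˡ k , ι₂ ]′ (vsplit w) ≡ w
    ι-vsplit w with splitAt (V (graph A)) w | join-splitAt (V (graph A)) k w
    ... | inj₁ u | eq = eq
    ... | inj₂ j | eq = trans (ι₂-inner j) eq
    ends′ : Fin (m (graph A)) ⊎ Fin m₂ → Fin (V (graph A) + k) × Fin (V (graph A) + k)
    ends′ = [ mapPair (_↑ˡ k) ∘ ends (graph A) , mapPair ι₂ ∘ ends₂ ]′

  parallelGluing : ParallelGluing A B (A ∥ B)
  parallelGluing = record
    { gluing = gluing ; ι₁-s = refl ; ι₁-t = refl ; ι₂-s = ι₂-s ; ι₂-t = ι₂-t
    ; vsplit-ι₂ = vsplit-ι₂ }

-- The same case split as in the definition of _∥_, so that A ∥ B unfolds to parallelAux.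
parallelGluing : (A B : TGraph) → ParallelGluing A B (A ∥ B)
parallelGluing A record { graph = record { V = zero } ; s = () }
parallelGluing A record { graph = record { V = suc zero } ; s = zero ; t = zero ; s≢t = s≢t } =
  contradiction refl s≢t
parallelGluing A record { graph = record { V = suc (suc k) ; m = m₂ ; ends = ends₂ }
                        ; s = s₂ ; t = t₂ ; s≢t = s≢t } =
  ParallelConstruction.parallelGluing A k m₂ ends₂ s₂ t₂ s≢t

module SerialConstruction (A : TGraph) (k m₂ : ℕ) (ends₂ : Fin m₂ → Fin (suc k) × Fin (suc k))
                          (s₂ t₂ : Fin (suc k)) (s₂≢t₂ : s₂ ≢ t₂)
  where
  B : TGraph
  B = record { graph = record { V = suc k ; m = m₂ ; ends = ends₂ } ; s = s₂ ; t = t₂ ; s≢t = s₂≢t₂ }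

  ι₂ : Fin (suc k) → Fin (V (graph A) + k)
  ι₂ = serVmap (V (graph A)) (t A) k s₂

  vsplit : Fin (V (graph A) + k) → Fin (V (graph A)) ⊎ Fin (suc k)
  vsplit w = [ inj₁ , inj₂ ∘ punchIn s₂ ]′ (splitAt (V (graph A)) w)

  ι₂-punchIn : ∀ j → ι₂ (punchIn s₂ j) ≡ V (graph A) ↑ʳ j
  ι₂-punchIn j with punchIn s₂ j ≟ s₂
  ... | yes eq = contradiction eq (punchInᵢ≢i s₂ j)
  ... | no _ = cong (V (graph A) ↑ʳ_) (trans (punchOut-cong s₂ refl) (punchOut-punchIn s₂))

  ι₂-s : ι₂ s₂ ≡ t A ↑ˡ k
  ι₂-s with s₂ ≟ s₂
  ... | yes _ = refl
  ... | no s₂≢s₂ = contradiction refl s₂≢s₂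

  vsplit-ι₂ : ∀ u → u ≢ s₂ → vsplit (ι₂ u) ≡ inj₂ u
  vsplit-ι₂ u u≢s with u ≟ s₂
  ... | yes eq = contradiction eq u≢s
  ... | no _ = trans (cong [ inj₁ , inj₂ ∘ punchIn s₂ ]′ (splitAt-↑ʳ (V (graph A)) k _))
                     (cong inj₂ (punchIn-punchOut _))

  gluing : Gluing (graph A) (graph B) (graph (A ⊕ B))
  gluing = record
    { ι₁ = _↑ˡ k
    ; ι₂ = ι₂
    ; vsplit = vsplit
    ; vsplit-ι₁ = λ u → cong [ inj₁ , inj₂ ∘ punchIn s₂ ]′ (splitAt-↑ˡ (V (graph A)) u k)
    ; ι-vsplit = ι-vsplit
    ; ε₁ = _↑ˡ m₂
    ; ε₂ = m (graph A) ↑ʳ_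
    ; esplit = splitAt (m (graph A))
    ; esplit-ε₁ = λ e → splitAt-↑ˡ (m (graph A)) e m₂
    ; esplit-ε₂ = splitAt-↑ʳ (m (graph A)) m₂
    ; ε-esplit = join-splitAt (m (graph A)) m₂
    ; ends-ε₁ = λ e → cong ends′ (splitAt-↑ˡ (m (graph A)) e m₂)
    ; ends-ε₂ = λ e → cong ends′ (splitAt-↑ʳ (m (graph A)) m₂ e) }
    where
    ι-vsplit : ∀ w → [ _↑ˡ k , ι₂ ]′ (vsplit w) ≡ w
    ι-vsplit w with splitAt (V (graph A)) w | join-splitAt (V (graph A)) k w
    ... | inj₁ u | eq = eq
    ... | inj₂ j | eq = trans (ι₂-punchIn j) eq
    ends′ : Fin (m (graph A)) ⊎ Fin m₂ → Fin (V (graph A) + k) × Fin (V (graph A) + k)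
    ends′ = [ mapPair (_↑ˡ k) ∘ ends (graph A) , mapPair ι₂ ∘ ends₂ ]′

  serialGluing : SerialGluing A B (A ⊕ B)
  serialGluing = record
    { gluing = gluing ; ι₁-s = refl ; ι₂-t = refl ; ι₂-s = ι₂-s ; vsplit-ι₂ = vsplit-ι₂ }

serialGluing : (A B : TGraph) → SerialGluing A B (A ⊕ B)
serialGluing A record { graph = record { V = zero } ; s = () }
serialGluing A record { graph = record { V = suc k ; m = m₂ ; ends = ends₂ } ; s = s₂ ; t = t₂ ; s≢t = s≢t } =
  SerialConstruction.serialGluing A k m₂ ends₂ s₂ t₂ s≢t

module ParallelSwap {A B P Q : TGraph} (𝒫 : ParallelGluing A B P) (𝒬 : ParallelGluing B A Q) where
  private
    module 𝒫 = ParallelGluingProperties 𝒫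
    module 𝒬 = ParallelGluingProperties 𝒬
  open ≡-Reasoning

  vswap : Fin (V (graph P)) → Fin (V (graph Q))
  vswap = [ 𝒬.ι₂ , 𝒬.ι₁ ]′ ∘ 𝒫.vsplit

  vswap-ι₁ : ∀ u → vswap (𝒫.ι₁ u) ≡ 𝒬.ι₂ u
  vswap-ι₁ u = cong [ 𝒬.ι₂ , 𝒬.ι₁ ]′ (𝒫.vsplit-ι₁ u)

  vswap-ι₂ : ∀ u → vswap (𝒫.ι₂ u) ≡ 𝒬.ι₁ u
  vswap-ι₂ u with u ≟ s B | u ≟ t B
  ... | yes refl | _ = begin
    vswap (𝒫.ι₂ (s B)) ≡⟨ cong vswap (trans 𝒫.ι₂-s (sym 𝒫.ι₁-s)) ⟩
    vswap (𝒫.ι₁ (s A)) ≡⟨ vswap-ι₁ (s A) ⟩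
    𝒬.ι₂ (s A)         ≡⟨ trans 𝒬.ι₂-s (sym 𝒬.ι₁-s) ⟩
    𝒬.ι₁ (s B)         ∎
  ... | no _ | yes refl = begin
    vswap (𝒫.ι₂ (t B)) ≡⟨ cong vswap (trans 𝒫.ι₂-t (sym 𝒫.ι₁-t)) ⟩
    vswap (𝒫.ι₁ (t A)) ≡⟨ vswap-ι₁ (t A) ⟩
    𝒬.ι₂ (t A)         ≡⟨ trans 𝒬.ι₂-t (sym 𝒬.ι₁-t) ⟩
    𝒬.ι₁ (t B)         ∎
  ... | no u≢s | no u≢t = cong [ 𝒬.ι₂ , 𝒬.ι₁ ]′ (𝒫.vsplit-ι₂ u u≢s u≢t)

  eswap : Fin (m (graph P)) → Fin (m (graph Q))
  eswap = [ 𝒬.ε₂ , 𝒬.ε₁ ]′ ∘ 𝒫.esplit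

  eswap-ε₁ : ∀ e → eswap (𝒫.ε₁ e) ≡ 𝒬.ε₂ e
  eswap-ε₁ e = cong [ 𝒬.ε₂ , 𝒬.ε₁ ]′ (𝒫.esplit-ε₁ e)

  eswap-ε₂ : ∀ e → eswap (𝒫.ε₂ e) ≡ 𝒬.ε₁ e
  eswap-ε₂ e = cong [ 𝒬.ε₂ , 𝒬.ε₁ ]′ (𝒫.esplit-ε₂ e)

  eswap-matches : ∀ e →
    Matches (graph Q) (eswap e) (vswap (proj₁ (ends (graph P) e))) (vswap (proj₂ (ends (graph P) e)))
  eswap-matches e with 𝒫.esplit e | 𝒫.ε-esplit e
  ... | inj₁ e₁ | refl rewrite 𝒫.ends-ε₁ e₁ | 𝒬.ends-ε₂ e₁ = inj₁ (vswap-ι₁ _ , vswap-ι₁ _)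
  ... | inj₂ e₂ | refl rewrite 𝒫.ends-ε₂ e₂ | 𝒬.ends-ε₁ e₂ = inj₁ (vswap-ι₂ _ , vswap-ι₂ _)

vswap-involutive : ∀ {A B P Q} (𝒫 : ParallelGluing A B P) (𝒬 : ParallelGluing B A Q) →
  ∀ w → ParallelSwap.vswap 𝒬 𝒫 (ParallelSwap.vswap 𝒫 𝒬 w) ≡ w
vswap-involutive 𝒫 𝒬 w with ParallelGluingProperties.vsplit 𝒫 w | ParallelGluingProperties.ι-vsplit 𝒫 w
... | inj₁ u | refl = ParallelSwap.vswap-ι₂ 𝒬 𝒫 u
... | inj₂ u | refl = ParallelSwap.vswap-ι₁ 𝒬 𝒫 u

eswap-involutive : ∀ {A B P Q} (𝒫 : ParallelGluing A B P) (𝒬 : ParallelGluing B A Q) →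
  ∀ e → ParallelSwap.eswap 𝒬 𝒫 (ParallelSwap.eswap 𝒫 𝒬 e) ≡ e
eswap-involutive 𝒫 𝒬 e with ParallelGluingProperties.esplit 𝒫 e | ParallelGluingProperties.ε-esplit 𝒫 e
... | inj₁ e₁ | refl = ParallelSwap.eswap-ε₂ 𝒬 𝒫 e₁
... | inj₂ e₂ | refl = ParallelSwap.eswap-ε₁ 𝒬 𝒫 e₂

parallel-≅ : ∀ {A B P Q} → ParallelGluing A B P → ParallelGluing B A Q → graph P ≅ graph Q
parallel-≅ 𝒫 𝒬 = record
  { vmap = mk↔ₛ′ (vswap 𝒫 𝒬) (vswap 𝒬 𝒫) (vswap-involutive 𝒬 𝒫) (vswap-involutive 𝒫 𝒬)
  ; emap = mk↔ₛ′ (eswap 𝒫 𝒬) (eswap 𝒬 𝒫) (eswap-involutive 𝒬 𝒫) (eswap-involutive 𝒫 𝒬)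
  ; incid = eswap-matches 𝒫 𝒬 }
  where open ParallelSwap

∥-comm : ∀ A B → graph (A ∥ B) ≅ graph (B ∥ A)
∥-comm A B = parallel-≅ (parallelGluing A B) (parallelGluing B A)

-- Forced sets of 2-terminal graphs

Forces : (G : TGraph) → (Fin (m (graph G)) → Bool) → Subset 5 → Set
Forces G f X = ForcingSub (_∈ X) G (edgeSubgraph (graph G) f)

ForcesProperly : TGraph → Subset 5 → Set
ForcesProperly G X = ∃[ f ] ((∃[ e ] f e ≡ false) × Forces G f X)

forcing-cong : ∀ {S S′ G H} → (∀ {x} → S x ⇔ S′ x) → ForcingSub S G H → ForcingSub S′ G H
forcing-cong S⇔S′ forcing x = mk⇔ (to (forcing x) ∘ from S⇔S′) (to S⇔S′ ∘ from (forcing x))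

forces-cong : ∀ {G f g X} → (∀ e → f e ≡ g e) → Forces G f X → Forces G g X
forces-cong {G} {f} {g} f≗g forces x = mk⇔
  (attainable-mono G (edgeSubgraph _ f) (edgeSubgraph _ g) (λ e k → trans (f≗g e) k) ∘ to (forces x))
  (from (forces x) ∘ attainable-mono G (edgeSubgraph _ g) (edgeSubgraph _ f) (λ e k → trans (sym (f≗g e)) k))

module _ {A B P : TGraph} (𝒮 : SerialGluing A B P) where
  open SerialGluingProperties 𝒮

  forces-serial : ∀ f {X Y} → Forces A (f ∘ ε₁) X → Forces B (f ∘ ε₂) Y → Forces P f (X ⊞ Y)
  forces-serial f forcesA forcesB x = mk⇔
    (λ x∈ → let (y , z , y∈ , z∈ , y+z) = to ∈-⊞ x∈ in
      from (attainable-serial f) (y , z , to (forcesA y) y∈ , to (forcesB z) z∈ , y+z))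
    (λ att → let (y , z , attA , attB , y+z) = to (attainable-serial f) att in
      from ∈-⊞ (y , z , from (forcesA y) attA , from (forcesB z) attB , y+z))

module _ {A B P : TGraph} (𝒫 : ParallelGluing A B P) where
  open ParallelGluingProperties 𝒫

  forces-parallel : ∀ f {X Y} → Forces A (f ∘ ε₁) X → Forces B (f ∘ ε₂) Y → Forces P f (X ∩ Y)
  forces-parallel f forcesA forcesB x = mk⇔
    (λ x∈ → let (x∈X , x∈Y) = to ∩⇔× x∈ in
      from (attainable-parallel f) (to (forcesA x) x∈X , to (forcesB x) x∈Y))
    (λ att → let (attA , attB) = to (attainable-parallel f) att in
      from ∩⇔× (from (forcesA x) attA , from (forcesB x) attB))

-- Profiles

record Profile : Set where
  constructor profile
  field
    forced : Subset 5
    proper : List (Subset 5)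
open Profile

combine : (Subset 5 → Subset 5 → Subset 5) → Profile → Profile → Profile
combine _⊙_ p q =
  profile (forced p ⊙ forced q) (map (_⊙ forced q) (proper p) ++ map (forced p ⊙_) (proper q))

serial parallel : Profile → Profile → Profile
serial = combine _⊞_
parallel = combine _∩_

_≼_ : Profile → Profile → Set
r ≼ a = forced r ≡ forced a × All (_∈ˡ proper a) (proper r)

_≼?_ : ∀ r a → Dec (r ≼ a)
r ≼? a = forced r ≟ˢ forced a ×-dec All.all? (λ X → Any.any? (X ≟ˢ_) (proper a)) (proper r)

CriticalProfile : Profile → Set
CriticalProfile a = Empty (forced a) × All Nonempty (proper a)

criticalProfile? : ∀ a → Dec (CriticalProfile a)
criticalProfile? a = ¬? (nonempty? (forced a)) ×-dec All.all? nonempty? (proper a)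

record Realises (G : TGraph) (a : Profile) : Set where
  field
    forces : Forces G (const true) (forced a)
    forces-proper : All (ForcesProperly G) (proper a)
open Realises

realises-≼ : ∀ {G r a} → r ≼ a → Realises G a → Realises G r
realises-≼ {G} (forced≡ , proper⊆) realises = record
  { forces = subst (Forces G (const true)) (sym forced≡) (forces realises)
  ; forces-proper = All.map (All.lookup (forces-proper realises)) proper⊆ }

module _ {A B P : TGraph} (𝒢 : Gluing (graph A) (graph B) (graph P))
         (_⊙_ : Subset 5 → Subset 5 → Subset 5)
         (forces-⊙ : ∀ f {X Y} → Forces A (f ∘ Gluing.ε₁ 𝒢) X → Forces B (f ∘ Gluing.ε₂ 𝒢) Y →
                                  Forces P f (X ⊙ Y))
         {p q : Profile} (realisesA : Realises A p) (realisesB : Realises B q) where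
  open GluingProperties 𝒢

  realises-combine : Realises P (combine _⊙_ p q)
  realises-combine = record
    { forces = forces-⊙ (const true) (forces realisesA) (forces realisesB)
    ; forces-proper = ++⁺ (map⁺ (All.map deleteFromA (forces-proper realisesA)))
                          (map⁺ (All.map deleteFromB (forces-proper realisesB))) }
    where
    deleteFromA : ∀ {X} → ForcesProperly A X → ForcesProperly P (X ⊙ forced q)
    deleteFromA (f , (e , e∉) , forcesX) =
      joinMask f (const true) , (ε₁ e , trans (joinMask-ε₁ f _ e) e∉) ,
      forces-⊙ _ (forces-cong {A} (sym ∘ joinMask-ε₁ f _) forcesX)
                 (forces-cong {B} (sym ∘ joinMask-ε₂ f _) (forces realisesB))
    deleteFromB : ∀ {Y} → ForcesProperly B Y → ForcesProperly P (forced p ⊙ Y)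
    deleteFromB (f , (e , e∉) , forcesY) =
      joinMask (const true) f , (ε₂ e , trans (joinMask-ε₂ _ f e) e∉) ,
      forces-⊙ _ (forces-cong {A} (sym ∘ joinMask-ε₁ _ f) (forces realisesA))
                 (forces-cong {B} (sym ∘ joinMask-ε₂ _ f) forcesY)

critical⇒criticalProfile : ∀ {G a} → Realises G a → C5Critical (graph G) → CriticalProfile a
critical⇒criticalProfile {G} {a} realises (uncolourable , critical) =
  empty , All.map nonempty (forces-proper realises)
  where
  empty : Empty (forced a)
  empty (x , x∈) = let (φ , col , _) = to (forces realises x) x∈ in uncolourable (φ , col)
  nonempty : ∀ {X} → ForcesProperly G X → Nonempty X
  nonempty (f , (e , e∉) , forcesX) =
    let (φ , col) = critical (edgeSubgraph _ f) (inj₂ (e , e∉)) in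
    _ , from (forcesX _) (attainable-colouring G (edgeSubgraph _ f) {φ} col)

k2Profile : Profile
k2Profile = profile (pair (# 1)) (⊤ ∷ [])

realises-K2 : Realises K2 k2Profile
realises-K2 = record
  { forces = λ x → mk⇔ (from (attainable-edge x) ∘ to (adjacent-zero x))
                       (from (adjacent-zero x) ∘ to (attainable-edge x))
  ; forces-proper = (const false , (zero , refl) , λ x →
      mk⇔ (const (edgeColouring x , (λ _ ()) , refl , refl)) (const ∈⊤)) ∷ [] }
  where
  edgeColouring : Fin 5 → Fin 2 → Fin 5
  edgeColouring x zero = zero
  edgeColouring x (suc zero) = x
  attainable-edge : ∀ x → Attainable K2 (full (graph K2)) x ⇔ AdjC5 zero x
  attainable-edge x = mk⇔ (λ (φ , col , φs , φt) → subst₂ AdjC5 φs φt (col zero refl))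
                          (λ adj → edgeColouring x , (λ { zero _ → adj }) , refl , refl)
  adjacent-zero : ∀ x → x ∈ pair (# 1) ⇔ AdjC5 zero x
  adjacent-zero x = mk⇔ (proj₁ (check x)) (proj₂ (check x))
    where
    check : ∀ x → (x ∈ pair (# 1) → AdjC5 zero x) × (AdjC5 zero x → x ∈ pair (# 1))
    check = toWitness {a? = all? λ x →
      (x ∈? pair (# 1) →-dec adj? zero x) ×-dec (adj? zero x →-dec x ∈? pair (# 1))} _

-- Closing k2Profile under serial and parallel, keeping only the ⊆-minimal sets in the proper-subgraph lists,
-- gives exactly these profiles.
reachable : List Profile
reachable =
  k2Profile ∷
  profile ⊥ (⊥ ∷ []) ∷
  profile ⊥ (pair (# 1) ∷ pair (# 2) ∷ []) ∷
  profile ⊥ (pair (# 1) ∷ ∁ (pair (# 1)) ∷ []) ∷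
  profile ⊥ (pair (# 1) ∷ pair (# 2) ∷ pair (# 0) ∷ []) ∷
  profile (pair (# 0)) (pair (# 0) ∷ []) ∷
  profile (pair (# 0)) (∁ (pair (# 2)) ∷ ∁ (pair (# 1)) ∷ []) ∷
  profile ⊤ (⊤ ∷ []) ∷
  profile (∁ (pair (# 2))) (∁ (pair (# 2)) ∷ []) ∷
  profile (∁ (pair (# 2))) (⊤ ∷ []) ∷
  profile (∁ (pair (# 1))) (∁ (pair (# 1)) ∷ []) ∷
  profile (∁ (pair (# 1))) (⊤ ∷ []) ∷
  profile (∁ (pair (# 0))) (⊤ ∷ []) ∷
  profile (∁ (pair (# 0))) (∁ (pair (# 0)) ∷ []) ∷
  profile (pair (# 1)) (∁ (pair (# 0)) ∷ []) ∷
  profile (pair (# 1)) (pair (# 1) ∷ []) ∷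
  profile (pair (# 1)) (∁ (pair (# 2)) ∷ ∁ (pair (# 0)) ∷ []) ∷
  profile (pair (# 2)) (pair (# 2) ∷ []) ∷
  profile (pair (# 2)) (∁ (pair (# 1)) ∷ ∁ (pair (# 0)) ∷ []) ∷
  []

ForAllPairs : (Profile → Profile → Set) → Set
ForAllPairs R = All (λ p → All (R p) reachable) reachable

forAllPairs? : ∀ {R} → (∀ p q → Dec (R p q)) → Dec (ForAllPairs R)
forAllPairs? R? = All.all? (λ p → All.all? (R? p) reachable) reachable

lookupPair : ∀ {R p q} → ForAllPairs R → p ∈ˡ reachable → q ∈ˡ reachable → R p q
lookupPair all p∈ q∈ = All.lookup (All.lookup all p∈) q∈

-- The exhaustive checks are opaque so that using them does not re-run them.
opaque
  reachable-closed : ForAllPairs λ p q → Any (_≼ serial p q) reachable × Any (_≼ parallel p q) reachable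
  reachable-closed = toWitness {a? = forAllPairs? λ p q →
    Any.any? (_≼? serial p q) reachable ×-dec Any.any? (_≼? parallel p q) reachable} _

opaque
  serial-not-critical : ForAllPairs λ p q → ¬ CriticalProfile (serial p q)
  serial-not-critical = toWitness {a? = forAllPairs? λ p q → ¬? (criticalProfile? (serial p q))} _

Complementary : Subset 5 → Subset 5 → Set
Complementary X Y = Σ (Fin 3) λ i →
  (X ≡ pair (i ↑ˡ 2) × Y ≡ ∁ (pair (i ↑ˡ 2))) ⊎ (X ≡ ∁ (pair (i ↑ˡ 2)) × Y ≡ pair (i ↑ˡ 2))

opaque
  parallel-critical-complementary :
    ForAllPairs λ p q → CriticalProfile (parallel p q) → Complementary (forced p) (forced q)
  parallel-critical-complementary = toWitness {a? = forAllPairs? λ p q →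
    criticalProfile? (parallel p q) →-dec any? λ i →
      (forced p ≟ˢ pair (i ↑ˡ 2) ×-dec forced q ≟ˢ ∁ (pair (i ↑ˡ 2))) ⊎-dec
      (forced p ≟ˢ ∁ (pair (i ↑ˡ 2)) ×-dec forced q ≟ˢ pair (i ↑ˡ 2))} _

realises-⊕ : ∀ {A B p q} → Realises A p → Realises B q → Realises (A ⊕ B) (serial p q)
realises-⊕ {A} {B} = realises-combine (SerialGluing.gluing 𝒮) _⊞_ (forces-serial 𝒮)
  where 𝒮 = serialGluing A B

realises-∥ : ∀ {A B p q} → Realises A p → Realises B q → Realises (A ∥ B) (parallel p q)
realises-∥ {A} {B} = realises-combine (ParallelGluing.gluing 𝒫) _∩_ (forces-parallel 𝒫)
  where 𝒫 = parallelGluing A B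

realisable : ∀ T → ∃[ a ] (a ∈ˡ reachable × Realises ⟦ T ⟧ a)
realisable edge = k2Profile , here refl , realises-K2
realisable (ser a b) with realisable a | realisable b
... | p , p∈ , realisesA | q , q∈ , realisesB =
  let (r , r∈ , r≼) = find (proj₁ (lookupPair reachable-closed p∈ q∈)) in
  r , r∈ , realises-≼ r≼ (realises-⊕ realisesA realisesB)
realisable (par a b) with realisable a | realisable b
... | p , p∈ , realisesA | q , q∈ , realisesB =
  let (r , r∈ , r≼) = find (proj₂ (lookupPair reachable-closed p∈ q∈)) in
  r , r∈ , realises-≼ r≼ (realises-∥ realisesA realisesB)

-- Minimally forcing graphs and critical parallel sums

all-true : ∀ {n} (f : Fin n → Bool) → ¬ (∃[ e ] f e ≡ false) → ∀ e → f e ≡ true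
all-true f none e with f e in eq
... | true = refl
... | false = contradiction (e , eq) none

minimallyForcing⇒unforced-attainable : ∀ {S} G f → Decidable S → MinimallyForcing S G →
  (∃[ e ] f e ≡ false) → ∃[ x ] (Attainable G (edgeSubgraph (graph G) f) x × ¬ S x)
minimallyForcing⇒unforced-attainable {S} G f S? (forcing , minimal) dropped =
  Prod.map₂ (decidable-stable (attainable&unforced? _))
    (¬∀⟶∃¬ 5 _ (¬? ∘ attainable&unforced?) λ none →
      minimal (edgeSubgraph _ f) (inj₂ dropped) refl refl λ x → mk⇔
        (attainable-spanning G f ∘ to (forcing x))
        (λ att → decidable-stable (S? x) λ ¬Sx → none x (att , ¬Sx)))
  where
  attainable&unforced? : ∀ x → Dec (Attainable G (edgeSubgraph (graph G) f) x × ¬ S x)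
  attainable&unforced? x = attainable? G (edgeSubgraph (graph G) f) x ×-dec ¬? (S? x)

minimallyForcing⇒¬isolated : ∀ {S G x y u} → MinimallyForcing S G → S x → ¬ S y → ¬ Isolated (graph G) u
minimallyForcing⇒¬isolated {S} {G} {x} {y} {u} (forcing , minimal) Sx ¬Sy isolated
  with to (forcing x) Sx | u ≟ s G | u ≟ t G
... | φ , col , φs , φt | yes refl | _ =
  ¬Sy (from (forcing y) (ψ , colouring-update isolated (full _) zero col′ , ψs , ψt))
  where
  open ≡-Reasoning
  φ′ : Fin (V (graph G)) → Fin 5
  φ′ = (y +₅_) ∘ (neg5 x +₅_) ∘ φ
  col′ : IsColouring (graph G) φ′
  col′ = colouring-+₅ (full _) {(neg5 x +₅_) ∘ φ} y (colouring-+₅ (full _) {φ} (neg5 x) col)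
  ψ : Fin (V (graph G)) → Fin 5
  ψ = updateAt φ′ (s G) (const zero)
  ψs : ψ (s G) ≡ zero
  ψs = updateAt-updates (s G) φ′
  ψt : ψ (t G) ≡ y
  ψt = begin
    ψ (t G)                   ≡⟨ updateAt-minimal (t G) (s G) φ′ (s≢t G ∘ sym) ⟩
    y +₅ neg5 x +₅ φ (t G)    ≡⟨ cong (λ c → y +₅ neg5 x +₅ c) φt ⟩
    y +₅ neg5 x +₅ x          ≡⟨ cong (y +₅_) (+₅-inverseˡ x) ⟩
    y +₅ zero                 ≡⟨ +₅-identityʳ y ⟩
    y                         ∎
... | φ , col , φs , φt | no _ | yes refl =
  ¬Sy (from (forcing y) (ψ , colouring-update isolated (full _) y col , ψs , ψt))
  where
  ψ : Fin (V (graph G)) → Fin 5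
  ψ = updateAt φ (t G) (const y)
  ψs : ψ (s G) ≡ zero
  ψs = trans (updateAt-minimal (s G) (t G) φ (s≢t G)) φs
  ψt : ψ (t G) ≡ y
  ψt = updateAt-updates (t G) φ
... | _ | no u≢s | no u≢t =
  -- deleting an isolated vertex keeps every edge, so forcing still proves ForcingSub S G (deleteIsolated isolated)
  minimal (deleteIsolated isolated) (deleteIsolated-proper isolated)
    (deleteIsolated-kept isolated (u≢s ∘ sym)) (deleteIsolated-kept isolated (u≢t ∘ sym)) forcing

module _ {A B P : TGraph} (𝒫 : ParallelGluing A B P) where
  open ParallelGluingProperties 𝒫

  module _ (critical : C5Critical (graph P)) where

    critical-parallel⇒common-colour : ∀ fA → (∃[ e ] fA e ≡ false) →
      ∃[ x ] (Attainable A (edgeSubgraph _ fA) x × Attainable B (full (graph B)) x)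
    critical-parallel⇒common-colour fA (e , e∉) =
      let (φ , col) = proj₂ critical (edgeSubgraph _ f) (inj₂ (ε₁ e , trans (joinMask-ε₁ _ _ e) e∉))
          (attA , attB) = to (attainable-parallel f) (attainable-colouring P (edgeSubgraph _ f) {φ} col)
      in _ , attainable-mono A (edgeSubgraph _ (f ∘ ε₁)) (edgeSubgraph _ fA) (λ e → trans (joinMask-ε₁ _ _ e)) attA
           , attainable-mono B (edgeSubgraph _ (f ∘ ε₂)) (full _) (λ e _ → joinMask-ε₂ _ _ e) attB
      where
      f : Fin (m (graph P)) → Bool
      f = joinMask fA (const true)

    critical-parallel⇒minimallyForcing : ∀ {S} → Forcing S A → MinimallyForcing S A
    critical-parallel⇒minimallyForcing {S} forcing = forcing , minimal
      where
      minimal : (H : Subgraph (graph A)) → Proper H → vkeep H (s A) ≡ true → vkeep H (t A) ≡ true →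
        ¬ ForcingSub S A H
      minimal H proper s∈H t∈H forcingH with any? (λ e → ekeep H e ≟ᵇ false)
      ... | yes dropped =
        let (x , attH , attB) = critical-parallel⇒common-colour (ekeep H) dropped
        in proj₁ critical (glued-colouring (full _) (to (forcing x) (from (forcingH x) attH)) attB)
      ... | no none =
        let (v , v∉H , isolated) = spanning-proper⇒isolated H (all-true (ekeep H) none) proper
            v≢s = kept≢dropped H s∈H v∉H ∘ sym
            v≢t = kept≢dropped H t∈H v∉H ∘ sym
        in critical⇒¬isolated critical (isolated-ι₁ (λ _ → ι₂≢ι₁ v≢s v≢t) isolated)

  module _ {S : Fin 5 → Set} (S? : Decidable S) {x y : Fin 5} (Sx : S x) (¬Sy : ¬ S y)
           (minimalA : MinimallyForcing S A) (minimalB : MinimallyForcing (λ z → ¬ S z) B) where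

    complementary-parallel⇒critical : C5Critical (graph P)
    complementary-parallel⇒critical = uncolourable , critical
      where
      forcingA : Forcing S A
      forcingA = proj₁ minimalA
      forcingB : Forcing (λ z → ¬ S z) B
      forcingB = proj₁ minimalB

      uncolourable : ¬ C5Colourable (graph P)
      uncolourable (φ , col) =
        let (attA , attB) = to (attainable-parallel (const true)) (attainable-colouring P (full (graph P)) {φ} col)
        in from (forcingB _) attB (from (forcingA _) attA)

      critical : (H : Subgraph (graph P)) → Proper H → ∃[ φ ] IsColouringOf H φ
      critical H proper
        with any? (λ e → ekeep H (ε₁ e) ≟ᵇ false) | any? (λ e → ekeep H (ε₂ e) ≟ᵇ false)
      ... | yes droppedA | _ =
        let (z , attA , ¬Sz) = minimallyForcing⇒unforced-attainable A (ekeep H ∘ ε₁) S? minimalA droppedA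
        in glued-colouring H attA (attainable-spanning B (ekeep H ∘ ε₂) (to (forcingB z) ¬Sz))
      ... | no _ | yes droppedB =
        let (z , attB , ¬¬Sz) = minimallyForcing⇒unforced-attainable B (ekeep H ∘ ε₂) (¬? ∘ S?) minimalB droppedB
            attA = attainable-spanning A (ekeep H ∘ ε₁) (to (forcingA z) (decidable-stable (S? z) ¬¬Sz))
        in glued-colouring H attA attB
      ... | no keptA | no keptB =
        let spanning = mask-split (ekeep H) (all-true (ekeep H ∘ ε₁) keptA) (all-true (ekeep H ∘ ε₂) keptB)
            (_ , _ , isolated) = spanning-proper⇒isolated H spanning proper
        in ⊥-elim ([ (minimallyForcing⇒¬isolated {G = A} minimalA Sx ¬Sy ∘ proj₂)
                   , (minimallyForcing⇒¬isolated {G = B} minimalB ¬Sy (λ ¬Sx → ¬Sx Sx) ∘ proj₂)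
                   ]′ (isolated-split isolated))

critical-∥⇒minimallyForcing : ∀ {S S′} A B → C5Critical (graph (A ∥ B)) →
  Forcing S A → Forcing S′ B → MinimallyForcing S A × MinimallyForcing S′ B
critical-∥⇒minimallyForcing A B critical forcingA forcingB =
  critical-parallel⇒minimallyForcing (parallelGluing A B) critical forcingA ,
  critical-parallel⇒minimallyForcing (parallelGluing B A) (critical-≅ (∥-comm B A) critical) forcingB

-- Critical series-parallel graphs

ForcingDecomposition : Graph → Set
ForcingDecomposition G = Σ (Fin 3) λ i → ∃[ G₁ ] ∃[ G₂ ]
  (InF (sset (i ↑ˡ 2)) G₁ × InF (sbar (i ↑ˡ 2)) G₂ × (G ≅ graph (G₁ ∥ G₂)))

decomposition-≅ : ∀ {G H} → G ≅ H → ForcingDecomposition H → ForcingDecomposition G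
decomposition-≅ G≅H (i , G₁ , G₂ , G₁∈F , G₂∈F , H≅) =
  i , G₁ , G₂ , G₁∈F , G₂∈F , ≅-trans G≅H H≅

≅ₜ-refl : ∀ {G} → G ≅ₜ G
≅ₜ-refl = record { iso = ≅-refl ; pres-s = refl ; pres-t = refl }

forcing-pair : ∀ {G a i} → Realises G a → forced a ≡ pair i → Forcing (sset i) G
forcing-pair {G} realises refl = forcing-cong {G = G} {full (graph G)} ∈-pair (forces realises)

forcing-∁pair : ∀ {G a i} → Realises G a → forced a ≡ ∁ (pair i) → Forcing (sbar i) G
forcing-∁pair {G} realises refl = forcing-cong {G = G} {full (graph G)} ∈-∁pair (forces realises)

critical-SP⇒decomposition : ∀ T → C5Critical (graph ⟦ T ⟧) → ForcingDecomposition (graph ⟦ T ⟧)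
critical-SP⇒decomposition edge critical =
  contradiction (# 1 , from ∈-pair (inj₁ refl)) (proj₁ (critical⇒criticalProfile realises-K2 critical))
critical-SP⇒decomposition (ser a b) critical with realisable a | realisable b
... | p , p∈ , realisesA | q , q∈ , realisesB =
  contradiction (critical⇒criticalProfile (realises-⊕ realisesA realisesB) critical)
                (lookupPair serial-not-critical p∈ q∈)
critical-SP⇒decomposition (par a b) critical with realisable a | realisable b
... | p , p∈ , realisesA | q , q∈ , realisesB
  with lookupPair parallel-critical-complementary p∈ q∈
         (critical⇒criticalProfile (realises-∥ realisesA realisesB) critical)
... | i , inj₁ (p≡ , q≡) =
  let (minimalA , minimalB) = critical-∥⇒minimallyForcing ⟦ a ⟧ ⟦ b ⟧ critical
                                (forcing-pair realisesA p≡) (forcing-∁pair realisesB q≡)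
  in i , ⟦ a ⟧ , ⟦ b ⟧ , ((a , ≅ₜ-refl) , minimalA) , ((b , ≅ₜ-refl) , minimalB) , ≅-refl
... | i , inj₂ (p≡ , q≡) =
  let (minimalA , minimalB) = critical-∥⇒minimallyForcing ⟦ a ⟧ ⟦ b ⟧ critical
                                (forcing-∁pair realisesA p≡) (forcing-pair realisesB q≡)
  in i , ⟦ b ⟧ , ⟦ a ⟧ , ((b , ≅ₜ-refl) , minimalB) , ((a , ≅ₜ-refl) , minimalA) , ∥-comm ⟦ a ⟧ ⟦ b ⟧

theorem3p3 : (G : Graph) → IsSeriesParallel G →
    C5Critical G ⇔
      (Σ (Fin 3) λ i → ∃[ G₁ ] ∃[ G₂ ] (InF (sset (i ↑ˡ 2)) G₁ × InF (sbar (i ↑ˡ 2)) G₂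
        × (G ≅ graph (G₁ ∥ G₂))))
theorem3p3 G (_ , _ , _ , T , T≅G) = mk⇔
  (λ critical → decomposition-≅ (≅-sym iso) (critical-SP⇒decomposition T (critical-≅ iso critical)))
  (λ (i , G₁ , G₂ , (_ , minimal₁) , (_ , minimal₂) , G≅) →
    critical-≅ G≅ (complementary-parallel⇒critical (parallelGluing G₁ G₂) (sset? (i ↑ˡ 2)) (inj₁ refl)
                    (proj₂ (sbar-nonempty (i ↑ˡ 2))) minimal₁ minimal₂))
  where
  iso : graph ⟦ T ⟧ ≅ G
  iso = _≅ₜ_.iso T≅G
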